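{- Let $N\ge2$, $n\ge3$ and $a,b,k\in\mathbb{Z}/N\mathbb{Z}$. If the $n$-tuple $(a,k,k,\dots,k,b)\in(\mathbb{Z}/N\mathbb{Z})^n$ (first entry $a$, last entry $b$, all other entries $k$) is a solution of $(E_N)$, then $a=b$ and $a(a-k)=0$.
   Context: For $a_1,\dots,a_n\in\mathbb{Z}/N\mathbb{Z}$ set $M_n(a_1,\dots,a_n)=\begin{pmatrix}a_n&-1\\1&0\end{pmatrix}\cdots\begin{pmatrix}a_1&-1\\1&0\end{pmatrix}$. An $n$-tuple is a solution of $(E_N)$ if $M_n(a_1,\dots,a_n)=\pm\mathrm{Id}$ over $\mathbb{Z}/N\mathbb{Z}$. -}

module Defs where

open import Data.Nat using (ℕ)
open import Data.Integer using (ℤ; +_; _+_; _-_; _*_; -_; 0ℤ; 1ℤ)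
open import Data.Integer.Divisibility using (_∣_)
open import Data.List using (List; []; _∷_; _++_; replicate; foldl)
open import Data.Sum using (_⊎_)
open import Data.Product using (_×_)

-- Z/NZ is represented by integers; equality in Z/NZ is congruence mod N.
infix 4 _≡_[mod_] _≡ₘ_[mod_]
_≡_[mod_] : ℤ → ℤ → ℕ → Set
x ≡ y [mod N ] = (+ N) ∣ (x - y)

record Mat : Set where
  constructor mat
  field
    m11 m12 m21 m22 : ℤ
open Mat public

_⊗_ : Mat → Mat → Mat
mat a b c d ⊗ mat e f g h = mat (a * e + b * g) (a * f + b * h) (c * e + d * g) (c * f + d * h)

M : ℤ → Mat
M a = mat a (- 1ℤ) 1ℤ 0ℤ

Id : Mat
Id = mat 1ℤ 0ℤ 0ℤ 1ℤ

-- M_n(a_1,...,a_n) = M(a_n) ⋯ M(a_1)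
Mₙ : List ℤ → Mat
Mₙ = foldl (λ acc a → M a ⊗ acc) Id

_≡ₘ_[mod_] : Mat → Mat → ℕ → Set
A ≡ₘ B [mod N ] =
  (m11 A ≡ m11 B [mod N ]) × (m12 A ≡ m12 B [mod N ]) ×
  (m21 A ≡ m21 B [mod N ]) × (m22 A ≡ m22 B [mod N ])

neg : Mat → Mat
neg (mat a b c d) = mat (- a) (- b) (- c) (- d)

IsSolution : ℕ → List ℤ → Set
IsSolution N as = (Mₙ as ≡ₘ Id [mod N ]) ⊎ (Mₙ as ≡ₘ neg Id [mod N ])

module Submission where

-- The powers of M k are the matrices x·Id + y·(M k − k·Id), so
-- M(b) M(k)ⁿ⁻² M(a) has entries polynomial in a, b, k, x, y.  Equating it with
-- s·Id, s = ±1, gives −x ≡ s, a·x ≡ y ≡ b·x and (a − k)·y ≡ 0 mod N; since x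
-- is a unit, a ≡ b and a·(a − k)·x² ≡ (a − k)·x·y ≡ 0.

open import Defs
open import Data.Nat using (ℕ; _≤_; _∸_)
open import Data.Integer using (ℤ; _-_; _*_; 0ℤ)
open import Data.List using (_∷_; []; _++_; replicate)
open import Data.Product using (_×_)

open import Data.Nat using (zero; suc)
open import Data.Integer using (_+_; -_; +_; 1ℤ; -1ℤ)
open import Data.Integer.Properties using (*-identityʳ)
open import Data.Integer.Tactic.RingSolver using (solve; solve-∀)
open import Data.Integer.Divisibility.Signed
  using (∣ᵤ⇒∣; ∣⇒∣ᵤ; ∣m∣n⇒∣m+n; ∣n⇒∣m*n)
  renaming (_∣_ to _∣ₛ_)
open import Data.List using (foldl; _∷ʳ_)
open import Data.List.Properties using (foldl-∷ʳ)
open import Data.Product using (_,_; ∃₂)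
open import Data.Sum using (_⊎_; inj₁; inj₂)
open import Relation.Binary.PropositionalEquality
  using (_≡_; refl; sym; trans; cong; subst; module ≡-Reasoning)

mat-≡ : ∀ {p q r t p′ q′ r′ t′} → p ≡ p′ → q ≡ q′ → r ≡ r′ → t ≡ t′ →
        mat p q r t ≡ mat p′ q′ r′ t′
mat-≡ refl refl refl refl = refl

row-col-assoc : ∀ p q e f g h i k →
  (p * e + q * g) * i + (p * f + q * h) * k ≡ p * (e * i + f * k) + q * (g * i + h * k)
row-col-assoc = solve-∀

⊗-assoc : ∀ A B C → (A ⊗ B) ⊗ C ≡ A ⊗ (B ⊗ C)
⊗-assoc (mat a b c d) (mat e f g h) (mat i j k l) =
  mat-≡ (row-col-assoc a b e f g h i k) (row-col-assoc a b e f g h j l)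
        (row-col-assoc c d e f g h i k) (row-col-assoc c d e f g h j l)

⊗-identityˡ : ∀ A → Id ⊗ A ≡ A
⊗-identityˡ (mat a b c d) = mat-≡ (first a c) (first b d) (second a c) (second b d)
  where
  first : ∀ x y → 1ℤ * x + 0ℤ * y ≡ x
  first = solve-∀
  second : ∀ x y → 0ℤ * x + 1ℤ * y ≡ y
  second = solve-∀

⊗-identityʳ : ∀ A → A ⊗ Id ≡ A
⊗-identityʳ (mat a b c d) = mat-≡ (first a b) (second a b) (first c d) (second c d)
  where
  first : ∀ x y → x * 1ℤ + y * 0ℤ ≡ x
  first = solve-∀
  second : ∀ x y → x * 0ℤ + y * 1ℤ ≡ y
  second = solve-∀

M-step : Mat → ℤ → Mat
M-step acc a = M a ⊗ acc

foldl-M-step-⊗ : ∀ xs X Y → foldl M-step (X ⊗ Y) xs ≡ foldl M-step X xs ⊗ Y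
foldl-M-step-⊗ []       X Y = refl
foldl-M-step-⊗ (a ∷ xs) X Y =
  trans (cong (λ Z → foldl M-step Z xs) (sym (⊗-assoc (M a) X Y)))
        (foldl-M-step-⊗ xs (M a ⊗ X) Y)

Mₙ-∷ : ∀ a xs → Mₙ (a ∷ xs) ≡ Mₙ xs ⊗ M a
Mₙ-∷ a xs = begin
  foldl M-step (M a ⊗ Id) xs
    ≡⟨ cong (λ Z → foldl M-step Z xs) (trans (⊗-identityʳ (M a)) (sym (⊗-identityˡ (M a)))) ⟩
  foldl M-step (Id ⊗ M a) xs
    ≡⟨ foldl-M-step-⊗ xs Id (M a) ⟩
  Mₙ xs ⊗ M a ∎
  where open ≡-Reasoning

Mₙ-∷ʳ : ∀ xs b → Mₙ (xs ∷ʳ b) ≡ M b ⊗ Mₙ xs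
Mₙ-∷ʳ xs b = foldl-∷ʳ M-step Id b xs

Mₙ-sandwich : ∀ a b xs → Mₙ ((a ∷ xs) ++ b ∷ []) ≡ M b ⊗ (Mₙ xs ⊗ M a)
Mₙ-sandwich a b xs = trans (Mₙ-∷ʳ (a ∷ xs) b) (cong (M b ⊗_) (Mₙ-∷ a xs))

-- x·Id + y·(M k − k·Id): the matrices commuting with M k.
pencil : ℤ → ℤ → ℤ → Mat
pencil k x y = mat x (- y) y (x - k * y)

pencil-⊗-M : ∀ k a x y → pencil k x y ⊗ M a ≡ mat (a * x - y) (- x) (x + (a - k) * y) (- y)
pencil-⊗-M k a x y = mat-≡ e₁₁ e₁₂ e₂₁ e₂₂
  where
  e₁₁ : x * a + - y * 1ℤ ≡ a * x - y
  e₁₁ = solve (a ∷ x ∷ y ∷ [])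
  e₁₂ : x * -1ℤ + - y * 0ℤ ≡ - x
  e₁₂ = solve (x ∷ y ∷ [])
  e₂₁ : y * a + (x - k * y) * 1ℤ ≡ x + (a - k) * y
  e₂₁ = solve (k ∷ a ∷ x ∷ y ∷ [])
  e₂₂ : y * -1ℤ + (x - k * y) * 0ℤ ≡ - y
  e₂₂ = solve (k ∷ x ∷ y ∷ [])

pencil-⊗-M-same : ∀ k x y → pencil k x y ⊗ M k ≡ pencil k (k * x - y) x
pencil-⊗-M-same k x y =
  trans (pencil-⊗-M k k x y) (mat-≡ refl refl (solve (k ∷ x ∷ y ∷ [])) (solve (k ∷ x ∷ y ∷ [])))

M-⊗ : ∀ b p q r t → M b ⊗ mat p q r t ≡ mat (b * p - r) (b * q - t) p q
M-⊗ b p q r t = mat-≡ (shift p r) (shift q t) (keep p r) (keep q t)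
  where
  shift : ∀ u v → b * u + -1ℤ * v ≡ b * u - v
  shift u v = solve (b ∷ u ∷ v ∷ [])
  keep : ∀ u v → 1ℤ * u + 0ℤ * v ≡ u
  keep u v = solve (u ∷ v ∷ [])

Mₙ-replicate : ∀ m k → ∃₂ λ x y → Mₙ (replicate m k) ≡ pencil k x y
Mₙ-replicate zero    k = 1ℤ , 0ℤ , mat-≡ refl refl refl (solve (k ∷ []))
Mₙ-replicate (suc m) k with Mₙ-replicate m k
... | x , y , Mₖᵐ≡pencil = k * x - y , x , (begin
  Mₙ (k ∷ replicate m k)   ≡⟨ Mₙ-∷ k (replicate m k) ⟩
  Mₙ (replicate m k) ⊗ M k ≡⟨ cong (_⊗ M k) Mₖᵐ≡pencil ⟩
  pencil k x y ⊗ M k       ≡⟨ pencil-⊗-M-same k x y ⟩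
  pencil k (k * x - y) x   ∎)
  where open ≡-Reasoning

sandwich-entries : ∀ k a b x y → M b ⊗ (pencil k x y ⊗ M a) ≡
  mat (b * (a * x - y) - (x + (a - k) * y)) (b * - x - - y) (a * x - y) (- x)
sandwich-entries k a b x y =
  trans (cong (M b ⊗_) (pencil-⊗-M k a x y)) (M-⊗ b (a * x - y) (- x) (x + (a - k) * y) (- y))

∣-cancel-unit² : ∀ {q} v s → s * s ≡ 1ℤ → q ∣ₛ v * (s * s) → q ∣ₛ v
∣-cancel-unit² {q} v s s²≡1 = subst (q ∣ₛ_) (trans (cong (v *_) s²≡1) (*-identityʳ v))

sandwich-entry-congruences : ∀ {q} a b k x y s → s * s ≡ 1ℤ →
  q ∣ₛ b * (a * x - y) - (x + (a - k) * y) - s → q ∣ₛ b * - x - - y - 0ℤ →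
  q ∣ₛ a * x - y - 0ℤ → q ∣ₛ - x - s →
  (q ∣ₛ a - b) × (q ∣ₛ a * (a - k) - 0ℤ)
sandwich-entry-congruences {q} a b k x y s s²≡1 h₁₁ h₁₂ h₂₁ h₂₂ =
  ∣-cancel-unit² (a - b) s s²≡1 [a-b]s²≡0 ,
  ∣-cancel-unit² (a * (a - k) - 0ℤ) s s²≡1 a[a-k]s²≡0
  where
  [a-b]s²-combination : (a - b) * (s * s) ≡
    - s * ((a * x - y - 0ℤ) + (b * - x - - y - 0ℤ)) + - s * (a - b) * (- x - s)
  [a-b]s²-combination = solve (a ∷ b ∷ x ∷ y ∷ s ∷ [])

  [a-b]s²≡0 : q ∣ₛ (a - b) * (s * s)
  [a-b]s²≡0 = subst (q ∣ₛ_) (sym [a-b]s²-combination)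
    (∣m∣n⇒∣m+n (∣n⇒∣m*n (- s) (∣m∣n⇒∣m+n h₂₁ h₁₂)) (∣n⇒∣m*n (- s * (a - b)) h₂₂))

  a[a-k]s²-combination : (a * (a - k) - 0ℤ) * (s * s) ≡
    (x - s) * (a * (a - k)) * (- x - s) + (a - k + b) * x * (a * x - y - 0ℤ)
    + x * (- x - s) + - x * (b * (a * x - y) - (x + (a - k) * y) - s)
  a[a-k]s²-combination = solve (a ∷ b ∷ k ∷ x ∷ y ∷ s ∷ [])

  a[a-k]s²≡0 : q ∣ₛ (a * (a - k) - 0ℤ) * (s * s)
  a[a-k]s²≡0 = subst (q ∣ₛ_) (sym a[a-k]s²-combination)
    (∣m∣n⇒∣m+n (∣m∣n⇒∣m+n (∣m∣n⇒∣m+n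
      (∣n⇒∣m*n ((x - s) * (a * (a - k))) h₂₂) (∣n⇒∣m*n ((a - k + b) * x) h₂₁))
      (∣n⇒∣m*n x h₂₂)) (∣n⇒∣m*n (- x) h₁₁))

infix 4 _≡±Id[mod_]
_≡±Id[mod_] : Mat → ℕ → Set
X ≡±Id[mod N ] = (X ≡ₘ Id [mod N ]) ⊎ (X ≡ₘ neg Id [mod N ])

sandwich-scalar-congruences : ∀ {N} k a b x y s → s * s ≡ 1ℤ →
  M b ⊗ (pencil k x y ⊗ M a) ≡ₘ mat s 0ℤ 0ℤ s [mod N ] →
  (a ≡ b [mod N ]) × (a * (a - k) ≡ 0ℤ [mod N ])
sandwich-scalar-congruences {N} k a b x y s s²≡1 X≡s
  with subst (_≡ₘ mat s 0ℤ 0ℤ s [mod N ]) (sandwich-entries k a b x y) X≡s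
... | h₁₁ , h₁₂ , h₂₁ , h₂₂
  with sandwich-entry-congruences {+ N} a b k x y s s²≡1
         (∣ᵤ⇒∣ h₁₁) (∣ᵤ⇒∣ h₁₂) (∣ᵤ⇒∣ h₂₁) (∣ᵤ⇒∣ h₂₂)
... | a≡b , a[a-k]≡0 = ∣⇒∣ᵤ a≡b , ∣⇒∣ᵤ a[a-k]≡0

sandwich-solution : ∀ {N} k a b x y → M b ⊗ (pencil k x y ⊗ M a) ≡±Id[mod N ] →
  (a ≡ b [mod N ]) × (a * (a - k) ≡ 0ℤ [mod N ])
sandwich-solution k a b x y (inj₁ ≡Id)  = sandwich-scalar-congruences k a b x y 1ℤ refl ≡Id
sandwich-solution k a b x y (inj₂ ≡-Id) = sandwich-scalar-congruences k a b x y -1ℤ refl ≡-Id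

-- The bounds on N and n are not needed: n = 2 is the case M(k)⁰ = Id.
proposition3p15 : (N n : ℕ) → 2 ≤ N → 3 ≤ n → (a b k : ℤ) →
    IsSolution N ((a ∷ replicate (n ∸ 2) k) ++ (b ∷ [])) →
    (a ≡ b [mod N ]) × (a * (a - k) ≡ 0ℤ [mod N ])
proposition3p15 N n _ _ a b k sol with Mₙ-replicate (n ∸ 2) k
... | x , y , Mₖⁿ⁻²≡pencil = sandwich-solution k a b x y (subst (_≡±Id[mod N ]) sandwich≡ sol)
  where
  sandwich≡ : Mₙ ((a ∷ replicate (n ∸ 2) k) ++ b ∷ []) ≡ M b ⊗ (pencil k x y ⊗ M a)
  sandwich≡ = trans (Mₙ-sandwich a b (replicate (n ∸ 2) k))
                    (cong (λ P → M b ⊗ (P ⊗ M a)) Mₖⁿ⁻²≡pencil)
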